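{- Let $\ell\geq 2$ and $r\geq 2$ be integers, let $a_1,a_2$ be real numbers and $b_1,b_2$ positive real numbers. Suppose that the arithmetic progressions $(a_1+(j-1)b_1)_{j=1}^{\ell}$ and $(a_2+(j-1)b_2)_{j=1}^{\ell}$ have at least $r$ common elements. Then $$\frac{b_1}{b_2}\in R_{\lfloor\frac{\ell-1}{r-1}\rfloor}.$$
   Context: For a positive integer $d$, $R_d=\{k/\ell' \mid k,\ell'\in\{1,\dots,d\}\}$. -}

module Defs where

open import Level using (Level; _⊔_) renaming (suc to lsuc)
open import Data.Nat using (ℕ; zero; suc; _≤_; _∸_; s≤s; z≤n; NonZero)
open import Data.Nat.DivMod using (_/_)
open import Data.Fin using (Fin; toℕ)
open import Data.Product using (Σ; ∃; _×_; _,_)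
open import Relation.Nullary using (¬_)
open import Relation.Binary.Core using (Rel)
open import Relation.Binary.Structures using (IsStrictTotalOrder)
open import Relation.Binary.PropositionalEquality using (_≡_)
open import Algebra.Bundles using (CommutativeRing)

-- An ordered field (the real numbers are the intended instance; the
-- stdlib has no reals).  Multiplicative inverse is a total operation
-- whose value at 0 is unconstrained; it is a genuine inverse on x ≉ 0.
record OrderedField c ℓ₁ ℓ₂ : Set (lsuc (c ⊔ ℓ₁ ⊔ ℓ₂)) where
  field
    commutativeRing : CommutativeRing c ℓ₁
  open CommutativeRing commutativeRing public
  infix 4 _<_
  infix 8 _⁻¹
  field
    _<_                : Rel Carrier ℓ₂
    isStrictTotalOrder : IsStrictTotalOrder _≈_ _<_
    +-monoˡ-<          : ∀ {x y} z → x < y → x + z < y + z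
    *-pos              : ∀ {x y} → 0# < x → 0# < y → 0# < x * y
    0≉1                : ¬ (0# ≈ 1#)
    _⁻¹                : Carrier → Carrier
    ⁻¹-cong            : ∀ {x y} → x ≈ y → x ⁻¹ ≈ y ⁻¹
    ⁻¹-inverseʳ        : ∀ x → ¬ (x ≈ 0#) → x * x ⁻¹ ≈ 1#

  ι : ℕ → Carrier
  ι zero    = 0#
  ι (suc n) = 1# + ι n

  _÷_ : Carrier → Carrier → Carrier
  x ÷ y = x * y ⁻¹

  InAP : Carrier → Carrier → ℕ → Carrier → Set (ℓ₁)
  InAP a b ℓ x = Σ (Fin ℓ) λ i → x ≈ a + ι (toℕ i) * b

  AtLeastCommon : ℕ → Carrier → Carrier → Carrier → Carrier → ℕ → Set (c ⊔ ℓ₁)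
  AtLeastCommon ℓ a₁ b₁ a₂ b₂ r =
    Σ (Fin r → Carrier) λ f →
      (∀ s t → f s ≈ f t → s ≡ t) ×
      (∀ s → InAP a₁ b₁ ℓ (f s) × InAP a₂ b₂ ℓ (f s))

  InR : ℕ → Carrier → Set ℓ₁
  InR d q = Σ ℕ λ k → Σ ℕ λ l′ →
    (1 ≤ k) × (k ≤ d) × (1 ≤ l′) × (l′ ≤ d) × (q ≈ ι k ÷ ι l′)

2≤⇒nonZero∸1 : ∀ {r} → 2 ≤ r → NonZero (r ∸ 1)
2≤⇒nonZero∸1 (s≤s (s≤s _)) = record { nonZero = _ }

floorQuot : (ℓ r : ℕ) → 2 ≤ r → ℕ
floorQuot ℓ r hr = _/_ (ℓ ∸ 1) (r ∸ 1) {{2≤⇒nonZero∸1 hr}}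

-- If t = a₁ + i b₁ = a₂ + j b₂ and t′ = a₁ + i′ b₁ = a₂ + j′ b₂ are two common terms, then
-- (i′ − i) b₁ = (j′ − j) b₂ with both differences of the same sign, so b₁/b₂ = p/q with p, q
-- positive and coprime. Then i p − j q is the same for every common term, so coprimality makes
-- the first indices of the r common terms pairwise congruent modulo q. Being r distinct numbers
-- in {0, …, ℓ − 1}, they force q (r − 1) ≤ ℓ − 1; symmetrically p (r − 1) ≤ ℓ − 1.
module Submission where

open import Defs
open import Level using (Level)
open import Data.Nat using (ℕ; _≤_)

open import Data.Fin using (Fin; toℕ; zero; suc)
open import Data.Fin.Properties using (toℕ≤pred[n]; 0≢1+n)
open import Function using (_∘_)
import Data.Nat as ℕ
open import Data.Nat using (s≤s; >-nonZero⁻¹)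
open import Data.Nat.Coprimality using (Coprime)
open import Data.Product using (Σ; _×_; _,_; proj₁; proj₂)
open import Function.Definitions using (Injective)
open import Relation.Binary.PropositionalEquality as ≡ using (_≡_)

module NatLemmas where

  open import Data.Fin using (fromℕ<)
  open import Data.Fin.Properties using (toℕ-fromℕ<; injective⇒≤)
  open import Data.Nat
  open import Data.Nat.Properties
  open import Data.Nat.DivMod
  open import Data.Nat.Tactic.RingSolver using (solve-∀)
  open import Data.Nat.Divisibility using (_∣_; n∣m*n; ∣m+n∣m⇒∣n)
  open import Data.Nat.Coprimality using (coprime-divisor)
  import Data.Nat.Coprimality as Coprime
  open import Data.Sum using (inj₁; inj₂)
  open ≡ using (refl; cong; cong₂; subst)

  m<n⇒∃[o]m+suc[o]≡n : ∀ {m n} → m < n → Σ ℕ λ o → m + suc o ≡ n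
  m<n⇒∃[o]m+suc[o]≡n {m} m<n with o , e ← m≤n⇒∃[o]m+o≡n m<n = o , ≡.trans (+-suc m o) e

  m*n≤o⇒m≤o/n : ∀ m n o .{{_ : NonZero n}} → m * n ≤ o → m ≤ o / n
  m*n≤o⇒m≤o/n m n o h = subst (_≤ o / n) (m*n/n≡m m n) (/-monoˡ-≤ n h)

  private
    ≤⇒m*p+n*q≡o*p+k*q⇒m%q≡o%q : ∀ m n o k {p q} .{{_ : NonZero q}} → Coprime q p → m ≤ o →
                                m * p + n * q ≡ o * p + k * q → m % q ≡ o % q
    ≤⇒m*p+n*q≡o*p+k*q⇒m%q≡o%q m n o k {p} {q} q⊥p m≤o e
      with d , refl ← m≤n⇒∃[o]m+o≡n m≤o = ≡.sym (%-remove-+ʳ m q∣d)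
      where
      regroup : ∀ m d p k q → (m + d) * p + k * q ≡ m * p + (k * q + p * d)
      regroup = solve-∀
      n*q≡k*q+p*d : n * q ≡ k * q + p * d
      n*q≡k*q+p*d = +-cancelˡ-≡ (m * p) _ _ (≡.trans e (regroup m d p k q))
      q∣d : q ∣ d
      q∣d = coprime-divisor q⊥p (∣m+n∣m⇒∣n (subst (q ∣_) n*q≡k*q+p*d (n∣m*n n)) (n∣m*n k))

  m*p+n*q≡o*p+k*q⇒m%q≡o%q : ∀ m n o k {p q} .{{_ : NonZero q}} → Coprime q p →
                            m * p + n * q ≡ o * p + k * q → m % q ≡ o % q
  m*p+n*q≡o*p+k*q⇒m%q≡o%q m n o k q⊥p e with ≤-total m o
  ... | inj₁ m≤o = ≤⇒m*p+n*q≡o*p+k*q⇒m%q≡o%q m n o k q⊥p m≤o e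
  ... | inj₂ o≤m = ≡.sym (≤⇒m*p+n*q≡o*p+k*q⇒m%q≡o%q o k m n q⊥p o≤m (≡.sym e))

  -- The quotients I s / q are pairwise distinct and at most M / q.
  injective-congruent⇒q*n≤M : ∀ {n M q} .{{_ : NonZero q}} (I : Fin (suc n) → ℕ) →
                              Injective _≡_ _≡_ I → (∀ s → I s ≤ M) →
                              (∀ s t → I s % q ≡ I t % q) → q * n ≤ M
  injective-congruent⇒q*n≤M {n} {M} {q} I I-inj I≤M I%q = begin
    q * n        ≤⟨ *-monoʳ-≤ q (s≤s⁻¹ (injective⇒≤ quotient-injective)) ⟩
    q * (M / q)  ≡⟨ *-comm q (M / q) ⟩
    M / q * q    ≤⟨ m/n*n≤m M q ⟩
    M            ∎
    where
    open ≤-Reasoning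
    quotient : Fin (suc n) → Fin (suc (M / q))
    quotient s = fromℕ< (s≤s (/-monoˡ-≤ q (I≤M s)))
    quotient-injective : Injective _≡_ _≡_ quotient
    quotient-injective {s} {t} e = I-inj (begin-equality
      I s                    ≡⟨ m≡m%n+[m/n]*n (I s) q ⟩
      I s % q + I s / q * q  ≡⟨ cong₂ (λ u v → u + v * q) (I%q s t) I/q≡ ⟩
      I t % q + I t / q * q  ≡⟨ m≡m%n+[m/n]*n (I t) q ⟨
      I t                    ∎)
      where
      I/q≡ : I s / q ≡ I t / q
      I/q≡ = ≡.trans (≡.sym (toℕ-fromℕ< _)) (≡.trans (cong toℕ e) (toℕ-fromℕ< _))

  -- The hypothesis says that I s * p − J s * q does not depend on s.
  collinear⇒bounds : ∀ {n M p q} .{{_ : NonZero p}} .{{_ : NonZero q}} → Coprime q p →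
                     (I J : Fin (suc n) → ℕ) →
                     (∀ s t → I s * p + J t * q ≡ I t * p + J s * q) →
                     Injective _≡_ _≡_ I → Injective _≡_ _≡_ J →
                     (∀ s → I s ≤ M) → (∀ s → J s ≤ M) →
                     q * n ≤ M × p * n ≤ M
  collinear⇒bounds {p = p} {q} q⊥p I J collinear I-inj J-inj I≤M J≤M =
    injective-congruent⇒q*n≤M I I-inj I≤M I%q ,
    injective-congruent⇒q*n≤M J J-inj J≤M J%p
    where
    I%q : ∀ s t → I s % q ≡ I t % q
    I%q s t = m*p+n*q≡o*p+k*q⇒m%q≡o%q (I s) (J t) (I t) (J s) q⊥p (collinear s t)
    J%p : ∀ s t → J s % p ≡ J t % p
    J%p s t = ≡.sym (m*p+n*q≡o*p+k*q⇒m%q≡o%q (J t) (I s) (J s) (I t) (Coprime.sym q⊥p)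
      (≡.trans (+-comm (J t * q) (I s * p))
        (≡.trans (collinear s t) (+-comm (I t * p) (J s * q)))))

open NatLemmas using (m<n⇒∃[o]m+suc[o]≡n; m*n≤o⇒m≤o/n; collinear⇒bounds)

module OrderedFieldProperties {c ℓ₁ ℓ₂} (F : OrderedField c ℓ₁ ℓ₂) where

  open import Data.Empty using (⊥-elim)
  open import Data.Nat.Properties using (<-cmp; <-≤-connex; m≤n⇒∃[o]m+o≡n)
  open import Data.Nat.DivMod using (m/n*n≡m; m≥n⇒m/n>0)
  open import Data.Nat.Divisibility using (∣⇒≤)
  open import Data.Nat.GCD using (gcd; gcd[m,n]≢0; gcd[m,n]∣m; gcd[m,n]∣n)
  open import Data.Nat.Coprimality using (coprime-/gcd)
  open import Data.Sum using (inj₁; inj₂)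
  open import Relation.Binary.Definitions using (tri<; tri≈; tri>)
  open import Relation.Nullary using (¬_)
  open ≡ using (_≢_)

  open OrderedField F
  open import Relation.Binary.Structures using (IsStrictTotalOrder)
  open IsStrictTotalOrder isStrictTotalOrder
    using (compare; irrefl; <-respˡ-≈; <-respʳ-≈) renaming (trans to <-trans)
  open import Algebra.Properties.Ring ring
    using (+-cancelˡ; +-identityʳ-unique; -1*x≈-x; -‿involutive)
  open import Algebra.Properties.Semiring.Mult semiring
    using (×-homo-+; ×1-homo-*) renaming (_×_ to _×ₙ_)
  import Algebra.Properties.CommutativeSemigroup as CommSemigroup
  module +-CS = CommSemigroup +-commutativeSemigroup
  module *-CS = CommSemigroup *-commutativeSemigroup
  open import Algebra.Solver.Ring.NaturalCoefficients.Default commutativeSemiring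
    using (solve; _:=_; _:+_; _:*_)
  open import Relation.Binary.Reasoning.Setoid setoid

  0<x⇒x≉0 : ∀ {x} → 0# < x → ¬ (x ≈ 0#)
  0<x⇒x≉0 0<x x≈0 = irrefl (sym x≈0) 0<x

  +-pos : ∀ {x y} → 0# < x → 0# < y → 0# < x + y
  +-pos {x} {y} 0<x 0<y = <-trans 0<y (<-respˡ-≈ (+-identityˡ y) (+-monoˡ-< y 0<x))

  -- If 1 < 0 then 0 < -1, and then 0 < -1 * -1 ≈ 1.
  0<1 : 0# < 1#
  0<1 with compare 0# 1#
  ... | tri< 0<1 _ _ = 0<1
  ... | tri≈ _ 0≈1 _ = ⊥-elim (0≉1 0≈1)
  ... | tri> _ _ 1<0 = ⊥-elim (irrefl refl (<-trans 0<1′ 1<0))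
    where
    0<-1 : 0# < - 1#
    0<-1 = <-respˡ-≈ (-‿inverseʳ 1#) (<-respʳ-≈ (+-identityˡ (- 1#)) (+-monoˡ-< (- 1#) 1<0))
    0<1′ : 0# < 1#
    0<1′ = <-respʳ-≈ (trans (-1*x≈-x (- 1#)) (-‿involutive 1#)) (*-pos 0<-1 0<-1)

  *-cancelʳ-≉0 : ∀ {x y} z → ¬ (z ≈ 0#) → x * z ≈ y * z → x ≈ y
  *-cancelʳ-≉0 {x} {y} z z≉0 e = begin
    x             ≈⟨ x≈x*z*z⁻¹ x ⟩
    x * z * z ⁻¹  ≈⟨ *-congʳ e ⟩
    y * z * z ⁻¹  ≈⟨ x≈x*z*z⁻¹ y ⟨
    y                ∎
    where
    x≈x*z*z⁻¹ : ∀ x → x ≈ x * z * z ⁻¹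
    x≈x*z*z⁻¹ x = begin
      x               ≈⟨ *-identityʳ x ⟨
      x * 1#          ≈⟨ *-congˡ (⁻¹-inverseʳ z z≉0) ⟨
      x * (z * z ⁻¹)  ≈⟨ *-assoc x z (z ⁻¹) ⟨
      x * z * z ⁻¹     ∎

  ÷-cong-cross : ∀ {x y z w} → ¬ (y ≈ 0#) → ¬ (w ≈ 0#) → x * w ≈ z * y → x ÷ y ≈ z ÷ w
  ÷-cong-cross {x} {y} {z} {w} y≉0 w≉0 e = begin
    x * y ⁻¹               ≈⟨ *-identityʳ _ ⟨
    x * y ⁻¹ * 1#          ≈⟨ *-congˡ (⁻¹-inverseʳ w w≉0) ⟨
    x * y ⁻¹ * (w * w ⁻¹)  ≈⟨ regroup x y w ⟩
    x * w * (y ⁻¹ * w ⁻¹)  ≈⟨ *-congʳ e ⟩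
    z * y * (y ⁻¹ * w ⁻¹)  ≈⟨ regroup′ z y w ⟩
    z * w ⁻¹ * (y * y ⁻¹)  ≈⟨ *-congˡ (⁻¹-inverseʳ y y≉0) ⟩
    z * w ⁻¹ * 1#          ≈⟨ *-identityʳ _ ⟩
    z * w ⁻¹                        ∎
    where
    regroup : ∀ x y w → x * y ⁻¹ * (w * w ⁻¹) ≈ x * w * (y ⁻¹ * w ⁻¹)
    regroup x y w = solve 4 (λ x yi w wi → (x :* yi) :* (w :* wi) := (x :* w) :* (yi :* wi))
                            refl x (y ⁻¹) w (w ⁻¹)
    regroup′ : ∀ z y w → z * y * (y ⁻¹ * w ⁻¹) ≈ z * w ⁻¹ * (y * y ⁻¹)
    regroup′ z y w = solve 4 (λ z y yi wi → (z :* y) :* (yi :* wi) := (z :* wi) :* (y :* yi))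
                             refl z y (y ⁻¹) (w ⁻¹)

  ι≈×1 : ∀ n → ι n ≈ n ×ₙ 1#
  ι≈×1 ℕ.zero    = refl
  ι≈×1 (ℕ.suc n) = +-congˡ (ι≈×1 n)

  ι-+ : ∀ m n → ι (m ℕ.+ n) ≈ ι m + ι n
  ι-+ m n = begin
    ι (m ℕ.+ n)        ≈⟨ ι≈×1 (m ℕ.+ n) ⟩
    (m ℕ.+ n) ×ₙ 1#    ≈⟨ ×-homo-+ 1# m n ⟩
    m ×ₙ 1# + n ×ₙ 1#  ≈⟨ +-cong (ι≈×1 m) (ι≈×1 n) ⟨
    ι m + ι n            ∎

  ι-* : ∀ m n → ι (m ℕ.* n) ≈ ι m * ι n
  ι-* m n = begin
    ι (m ℕ.* n)          ≈⟨ ι≈×1 (m ℕ.* n) ⟩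
    (m ℕ.* n) ×ₙ 1#      ≈⟨ ×1-homo-* m n ⟩
    m ×ₙ 1# * (n ×ₙ 1#)  ≈⟨ *-cong (ι≈×1 m) (ι≈×1 n) ⟨
    ι m * ι n            ∎

  0<ι[1+n] : ∀ n → 0# < ι (ℕ.suc n)
  0<ι[1+n] ℕ.zero    = <-respʳ-≈ (sym (+-identityʳ 1#)) 0<1
  0<ι[1+n] (ℕ.suc n) = +-pos 0<1 (0<ι[1+n] n)

  ι-nonZero : ∀ n .{{_ : ℕ.NonZero n}} → ¬ (ι n ≈ 0#)
  ι-nonZero (ℕ.suc n) = 0<x⇒x≉0 (0<ι[1+n] n)

  ι-injective : ∀ {m n} → ι m ≈ ι n → m ≡ n
  ι-injective {ℕ.zero}  {ℕ.zero}  _ = ≡.refl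
  ι-injective {ℕ.zero}  {ℕ.suc n} e = ⊥-elim (ι-nonZero (ℕ.suc n) (sym e))
  ι-injective {ℕ.suc m} {ℕ.zero}  e = ⊥-elim (ι-nonZero (ℕ.suc m) e)
  ι-injective {ℕ.suc m} {ℕ.suc n} e = ≡.cong ℕ.suc (ι-injective (+-cancelˡ 1# _ _ e))

  decompositions⇒x+y≈x′+y′ : ∀ {u v a₁ a₂ x y x′ y′} →
                             u ≈ a₁ + x → u ≈ a₂ + y′ → v ≈ a₁ + x′ → v ≈ a₂ + y →
                             x + y ≈ x′ + y′
  decompositions⇒x+y≈x′+y′ {u} {v} {a₁} {a₂} {x} {y} {x′} {y′} u₁ u₂ v₁ v₂ =
    +-cancelˡ (a₁ + a₂) _ _ (begin
      (a₁ + a₂) + (x + y)    ≈⟨ +-CS.interchange a₁ a₂ x y ⟩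
      (a₁ + x) + (a₂ + y)    ≈⟨ +-cong u₁ v₂ ⟨
      u + v                  ≈⟨ +-comm u v ⟩
      v + u                  ≈⟨ +-cong v₁ u₂ ⟩
      (a₁ + x′) + (a₂ + y′)  ≈⟨ +-CS.interchange a₁ a₂ x′ y′ ⟨
      (a₁ + a₂) + (x′ + y′)    ∎)

  module Ratio (b₁ b₂ : Carrier) (0<b₁ : 0# < b₁) (0<b₂ : 0# < b₂) where

    -- b₁ ÷ b₂ ≈ ι p ÷ ι q, stated without division
    HasRatio : ℕ → ℕ → Set ℓ₁
    HasRatio p q = ι q * b₁ ≈ ι p * b₂

    lincomb : ℕ → ℕ → Carrier
    lincomb x y = ι x * b₁ + ι y * b₂

    lincomb-+ˡ : ∀ x a y → lincomb (x ℕ.+ a) y ≈ lincomb x y + ι a * b₁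
    lincomb-+ˡ x a y = begin
      ι (x ℕ.+ a) * b₁ + ι y * b₂     ≈⟨ +-congʳ (*-congʳ (ι-+ x a)) ⟩
      (ι x + ι a) * b₁ + ι y * b₂     ≈⟨ +-congʳ (distribʳ b₁ (ι x) (ι a)) ⟩
      ι x * b₁ + ι a * b₁ + ι y * b₂  ≈⟨ +-CS.xy∙z≈xz∙y _ _ _ ⟩
      lincomb x y + ι a * b₁                  ∎

    lincomb-+ʳ : ∀ x y b → lincomb x (y ℕ.+ b) ≈ lincomb x y + ι b * b₂
    lincomb-+ʳ x y b = begin
      ι x * b₁ + ι (y ℕ.+ b) * b₂       ≈⟨ +-congˡ (*-congʳ (ι-+ y b)) ⟩
      ι x * b₁ + (ι y + ι b) * b₂       ≈⟨ +-congˡ (distribʳ b₂ (ι y) (ι b)) ⟩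
      ι x * b₁ + (ι y * b₂ + ι b * b₂)  ≈⟨ +-assoc _ _ _ ⟨
      lincomb x y + ι b * b₂                  ∎

    0<lincomb : ∀ k y → 0# < lincomb (ℕ.suc k) y
    0<lincomb k ℕ.zero    = <-respʳ-≈ (sym (trans (+-congˡ (zeroˡ b₂)) (+-identityʳ _)))
                                   (*-pos (0<ι[1+n] k) 0<b₁)
    0<lincomb k (ℕ.suc m) = +-pos (*-pos (0<ι[1+n] k) 0<b₁) (*-pos (0<ι[1+n] m) 0<b₂)

    -- Moving right along the first coordinate must be compensated by moving left along the second.
    lincomb-≈⇒ratio : ∀ x y k y′ → lincomb x y ≈ lincomb (x ℕ.+ ℕ.suc k) y′ →
                   Σ ℕ λ m → HasRatio (ℕ.suc m) (ℕ.suc k)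
    lincomb-≈⇒ratio x y k y′ e with <-≤-connex y′ y
    ... | inj₁ y′<y with m , ≡.refl ← m<n⇒∃[o]m+suc[o]≡n y′<y =
      m , sym (+-cancelˡ (lincomb x y′) _ _ (begin
        lincomb x y′ + ι (ℕ.suc m) * b₂  ≈⟨ lincomb-+ʳ x y′ (ℕ.suc m) ⟨
        lincomb x (y′ ℕ.+ ℕ.suc m)       ≈⟨ e ⟩
        lincomb (x ℕ.+ ℕ.suc k) y′       ≈⟨ lincomb-+ˡ x (ℕ.suc k) y′ ⟩
        lincomb x y′ + ι (ℕ.suc k) * b₁         ∎))
    ... | inj₂ y≤y′ with d , ≡.refl ← m≤n⇒∃[o]m+o≡n y≤y′ =
      ⊥-elim (0<x⇒x≉0 (0<lincomb k d) (+-identityʳ-unique (lincomb x y) _ (begin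
        lincomb x y + lincomb (ℕ.suc k) d          ≈⟨ +-assoc _ _ _ ⟨
        lincomb x y + ι (ℕ.suc k) * b₁ + ι d * b₂  ≈⟨ +-congʳ (lincomb-+ˡ x (ℕ.suc k) y) ⟨
        lincomb (x ℕ.+ ℕ.suc k) y + ι d * b₂       ≈⟨ lincomb-+ʳ (x ℕ.+ ℕ.suc k) y d ⟨
        lincomb (x ℕ.+ ℕ.suc k) (y ℕ.+ d)          ≈⟨ e ⟨
        lincomb x y                                            ∎)))

    lincomb-*-ι : ∀ {p q} → HasRatio p q → ∀ x y → lincomb x y * ι q ≈ ι (x ℕ.* p ℕ.+ y ℕ.* q) * b₂
    lincomb-*-ι {p} {q} q:p x y = begin
      (ι x * b₁ + ι y * b₂) * ι q        ≈⟨ regroup (ι x) (ι y) (ι q) b₁ b₂ ⟩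
      ι x * (ι q * b₁) + ι y * ι q * b₂  ≈⟨ +-congʳ (*-congˡ q:p) ⟩
      ι x * (ι p * b₂) + ι y * ι q * b₂  ≈⟨ regroup′ (ι x) (ι y) (ι q) (ι p) b₂ ⟩
      (ι x * ι p + ι y * ι q) * b₂       ≈⟨ *-congʳ (+-cong (ι-* x p) (ι-* y q)) ⟨
      (ι (x ℕ.* p) + ι (y ℕ.* q)) * b₂   ≈⟨ *-congʳ (ι-+ (x ℕ.* p) (y ℕ.* q)) ⟨
      ι (x ℕ.* p ℕ.+ y ℕ.* q) * b₂         ∎
      where
      regroup : ∀ x y q b₁ b₂ → (x * b₁ + y * b₂) * q ≈ x * (q * b₁) + y * q * b₂
      regroup = solve 5 (λ x y q b₁ b₂ → (x :* b₁ :+ y :* b₂) :* q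
                                        := x :* (q :* b₁) :+ y :* q :* b₂) refl
      regroup′ : ∀ x y q p b₂ → x * (p * b₂) + y * q * b₂ ≈ (x * p + y * q) * b₂
      regroup′ = solve 5 (λ x y q p b₂ → x :* (p :* b₂) :+ y :* q :* b₂
                                         := (x :* p :+ y :* q) :* b₂) refl

    lincomb-≈⇒collinear : ∀ {p q} → HasRatio p q → ∀ x y x′ y′ → lincomb x y ≈ lincomb x′ y′ →
                       x ℕ.* p ℕ.+ y ℕ.* q ≡ x′ ℕ.* p ℕ.+ y′ ℕ.* q
    lincomb-≈⇒collinear {p} {q} q:p x y x′ y′ e = ι-injective (*-cancelʳ-≉0 b₂ (0<x⇒x≉0 0<b₂) (begin
      ι (x ℕ.* p ℕ.+ y ℕ.* q) * b₂  ≈⟨ lincomb-*-ι q:p x y ⟨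
      lincomb x y * ι q             ≈⟨ *-congʳ e ⟩
      lincomb x′ y′ * ι q           ≈⟨ lincomb-*-ι q:p x′ y′ ⟩
      ι (x′ ℕ.* p ℕ.+ y′ ℕ.* q) * b₂     ∎))

    HasRatio⇒÷ : ∀ p q .{{_ : ℕ.NonZero q}} → HasRatio p q → b₁ ÷ b₂ ≈ ι p ÷ ι q
    HasRatio⇒÷ p q q:p = ÷-cong-cross (0<x⇒x≉0 0<b₂) (ι-nonZero q) (trans (*-comm b₁ (ι q)) q:p)

    HasRatio-cancel : ∀ p q g .{{_ : ℕ.NonZero g}} → HasRatio (p ℕ.* g) (q ℕ.* g) → HasRatio p q
    HasRatio-cancel p q g qg:pg = *-cancelʳ-≉0 (ι g) (ι-nonZero g) (begin
      ι q * b₁ * ι g    ≈⟨ *-CS.xy∙z≈xz∙y _ _ _ ⟩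
      ι q * ι g * b₁    ≈⟨ *-congʳ (ι-* q g) ⟨
      ι (q ℕ.* g) * b₁  ≈⟨ qg:pg ⟩
      ι (p ℕ.* g) * b₂  ≈⟨ *-congʳ (ι-* p g) ⟩
      ι p * ι g * b₂    ≈⟨ *-CS.xy∙z≈xz∙y _ _ _ ⟨
      ι p * b₂ * ι g          ∎)

    record ReducedRatio : Set ℓ₁ where
      field
        num den          : ℕ
        num-nonZero      : ℕ.NonZero num
        den-nonZero      : ℕ.NonZero den
        coprime          : Coprime den num
        hasRatio         : HasRatio num den

    reduce : ∀ m k → HasRatio (ℕ.suc m) (ℕ.suc k) → ReducedRatio
    reduce m k q:p = record
      { num         = p ℕ./ g
      ; den         = q ℕ./ g
      ; num-nonZero = ℕ.>-nonZero (m≥n⇒m/n>0 (∣⇒≤ (gcd[m,n]∣n q p)))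
      ; den-nonZero = ℕ.>-nonZero (m≥n⇒m/n>0 (∣⇒≤ (gcd[m,n]∣m q p)))
      ; coprime     = coprime-/gcd q p
      ; hasRatio    = HasRatio-cancel (p ℕ./ g) (q ℕ./ g) g (≡.subst₂ HasRatio
                        (≡.sym (m/n*n≡m (gcd[m,n]∣n q p))) (≡.sym (m/n*n≡m (gcd[m,n]∣m q p))) q:p)
      }
      where
      p q g : ℕ
      p = ℕ.suc m
      q = ℕ.suc k
      g = gcd q p
      instance
        g-nonZero : ℕ.NonZero g
        g-nonZero = ℕ.≢-nonZero (gcd[m,n]≢0 q p (inj₁ λ ()))

    lincomb-≈⇒reducedRatio : ∀ x y x′ y′ → x ≢ x′ → lincomb x y ≈ lincomb x′ y′ → ReducedRatio
    lincomb-≈⇒reducedRatio x y x′ y′ x≢x′ e with <-cmp x x′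
    ... | tri≈ _ x≡x′ _ = ⊥-elim (x≢x′ x≡x′)
    ... | tri< x<x′ _ _
      with k , ≡.refl ← m<n⇒∃[o]m+suc[o]≡n x<x′
      with m , q:p ← lincomb-≈⇒ratio x y k y′ e = reduce m k q:p
    ... | tri> _ _ x′<x
      with k , ≡.refl ← m<n⇒∃[o]m+suc[o]≡n x′<x
      with m , q:p ← lincomb-≈⇒ratio x′ y′ k y (sym e) = reduce m k q:p

    module CommonTerms {ℓ r a₁ a₂} (common : AtLeastCommon ℓ a₁ b₁ a₂ b₂ r) where

      term : Fin r → Carrier
      term = proj₁ common

      I J : Fin r → ℕ
      I s = toℕ (proj₁ (proj₁ (proj₂ (proj₂ common) s)))
      J s = toℕ (proj₁ (proj₂ (proj₂ (proj₂ common) s)))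

      term≈₁ : ∀ s → term s ≈ a₁ + ι (I s) * b₁
      term≈₁ s = proj₂ (proj₁ (proj₂ (proj₂ common) s))

      term≈₂ : ∀ s → term s ≈ a₂ + ι (J s) * b₂
      term≈₂ s = proj₂ (proj₂ (proj₂ (proj₂ common) s))

      index-injective : ∀ {a b} (K : Fin r → ℕ) → (∀ s → term s ≈ a + ι (K s) * b) →
                        Injective _≡_ _≡_ K
      index-injective {a} {b} K term≈ {s} {t} e = proj₁ (proj₂ common) s t (begin
        term s           ≈⟨ term≈ s ⟩
        a + ι (K s) * b  ≡⟨ ≡.cong (λ k → a + ι k * b) e ⟩
        a + ι (K t) * b  ≈⟨ term≈ t ⟨
        term t             ∎)

      I-injective : Injective _≡_ _≡_ I
      I-injective = index-injective I term≈₁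

      J-injective : Injective _≡_ _≡_ J
      J-injective = index-injective J term≈₂

      I≤pred[ℓ] : ∀ s → I s ℕ.≤ ℕ.pred ℓ
      I≤pred[ℓ] s = toℕ≤pred[n] _

      J≤pred[ℓ] : ∀ s → J s ℕ.≤ ℕ.pred ℓ
      J≤pred[ℓ] s = toℕ≤pred[n] _

      lincomb-cross : ∀ s t → lincomb (I s) (J t) ≈ lincomb (I t) (J s)
      lincomb-cross s t = decompositions⇒x+y≈x′+y′ (term≈₁ s) (term≈₂ s) (term≈₁ t) (term≈₂ t)

      collinear : ∀ p q → HasRatio p q → ∀ s t →
                  I s ℕ.* p ℕ.+ J t ℕ.* q ≡ I t ℕ.* p ℕ.+ J s ℕ.* q
      collinear p q q:p s t = lincomb-≈⇒collinear q:p (I s) (J t) (I t) (J s) (lincomb-cross s t)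

      reducedRatio : ∀ s t → s ≢ t → ReducedRatio
      reducedRatio s t s≢t =
        lincomb-≈⇒reducedRatio (I s) (J t) (I t) (J s) (s≢t ∘ I-injective) (lincomb-cross s t)

lemma5 : ∀ {c ℓ₁ ℓ₂ : Level} (F : OrderedField c ℓ₁ ℓ₂) →
         let open OrderedField F in
         (ℓ r : ℕ) → 2 ≤ ℓ → (hr : 2 ≤ r) →
         (a₁ a₂ b₁ b₂ : Carrier) → 0# < b₁ → 0# < b₂ →
         AtLeastCommon ℓ a₁ b₁ a₂ b₂ r →
         InR (floorQuot ℓ r hr) (b₁ ÷ b₂)
lemma5 F ℓ r (s≤s {n = ℓ-1} _) (s≤s (s≤s {n = r-2} _)) a₁ a₂ b₁ b₂ 0<b₁ 0<b₂ common =
  num , den , >-nonZero⁻¹ num , m*n≤o⇒m≤o/n num _ _ (proj₂ bounds) ,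
  >-nonZero⁻¹ den , m*n≤o⇒m≤o/n den _ _ (proj₁ bounds) , HasRatio⇒÷ num den hasRatio
  where
  open OrderedFieldProperties F
  open Ratio b₁ b₂ 0<b₁ 0<b₂
  open CommonTerms common
  open ReducedRatio (reducedRatio zero (suc zero) 0≢1+n)
  instance
    num≢0 : ℕ.NonZero num
    num≢0 = num-nonZero
    den≢0 : ℕ.NonZero den
    den≢0 = den-nonZero
  bounds : den ℕ.* ℕ.suc r-2 ≤ ℓ-1 × num ℕ.* ℕ.suc r-2 ≤ ℓ-1
  bounds = collinear⇒bounds coprime I J (collinear num den hasRatio)
             I-injective J-injective I≤pred[ℓ] J≤pred[ℓ]
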